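{- Let $N$ be a positive integer and let $a_1,a_2,\dots,a_{2N+1}$ be a sequence in $\mathbb{Z}_N$ such that (i) $a_1 = a_2 = \cdots = a_N$, (ii) $a_i \neq a_1$ for all $i \geq N+1$, and (iii) $a_{N+1},\dots,a_{2N+1}$ contain at least two distinct elements. Then there is a subsequence of length $N$, say $b_1,\dots,b_N$, with $\sum_{i=1}^N b_i = 0$ in $\mathbb{Z}_N$, such that at least one of the $b_i$ equals $a_1$ and not all of the $b_i$ equal $a_1$. -}

module Defs where

open import Data.Nat using (ℕ; suc; _+_; _*_; _<_; _%_)
open import Data.Fin using (Fin; toℕ)
open import Data.List using (map; allFin)
open import Data.Nat.ListAction using (sum)

-- ℤ_N is represented by Fin N (residues 0..N-1); a sum in ℤ_N is zero iff
-- the sum of the representatives is divisible by N (we require N = suc n > 0).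
sumZN : ∀ {N m} → (Fin m → Fin (suc N)) → ℕ
sumZN {N} {m} b = sum (map (λ i → toℕ (b i)) (allFin m)) % suc N

-- a subsequence of length m of a sequence indexed by Fin k is given by a
-- strictly increasing choice of indices
StrictlyIncreasing : ∀ {m k} → (Fin m → Fin k) → Set
StrictlyIncreasing {m} s = ∀ (i j : Fin m) → toℕ i < toℕ j → toℕ (s i) < toℕ (s j)

-- Write N = n + 1 and c = a₁. Taking h copies of c from the head and a set T of k = N − h
-- tail terms x_j gives the sum h c + Σ_T x_j ≡ Σ_T (x_j − c) (mod N), so it suffices to
-- find a nonempty set T of fewer than N tail positions with Σ_T (x_j − c) ≡ 0. The N + 1
-- values x_j − c are not all congruent, hence two adjacent ones differ; inside a window of
-- N consecutive tail positions the N prefixes together with one prefix whose last element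
-- is moved one step further are N + 1 sets, and pigeonholing their sums gives two nested
-- sets whose difference is T.
module Submission where

open import Defs
open import Data.Bool using (Bool; true; false; if_then_else_; T)
open import Data.Bool.Properties using (T?)
open import Data.Empty using (⊥-elim)
open import Data.Fin using (Fin; toℕ; zero; suc) renaming (_<_ to _<ᶠ_)
open import Data.Fin.Properties using (pigeonhole; toℕ-fromℕ<; toℕ<n; toℕ-injective)
open import Data.List using (map; allFin)
open import Data.List.Properties using (map-tabulate)
open import Data.Nat using (ℕ; zero; suc; _+_; _*_; _∸_; _<_; _≤_; _<ᵇ_; _%_; z≤n; s≤s; s≤s⁻¹)
open import Data.Nat.DivMod using (_mod_; [m+kn]%n≡m%n; %-distribˡ-+; n%1≡0; m<n⇒m%n≡m)
open import Data.Nat.ListAction using (sum)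
open import Data.Nat.Properties
open import Data.Nat.Tactic.RingSolver using (solve-∀)
open import Algebra.Properties.CommutativeSemigroup +-commutativeSemigroup using (interchange)
open import Data.Product using (∃; ∃-syntax; _×_; _,_; map₂)
open import Data.Sum using (_⊎_; inj₁; inj₂)
open import Data.Vec.Functional using (_∷_)
open import Function using (_∘_; const; id)
open import Relation.Binary using (tri<; tri≈; tri>)
open import Relation.Binary.PropositionalEquality
open import Relation.Nullary using (¬_; yes; no)

sumBelow : ℕ → (ℕ → ℕ) → ℕ
sumBelow zero    f = 0
sumBelow (suc m) f = f 0 + sumBelow m (f ∘ suc)

sumBelow-suc : ∀ m f → sumBelow (suc m) f ≡ sumBelow m f + f m
sumBelow-suc zero    f = +-comm (f 0) 0
sumBelow-suc (suc m) f = trans (cong (f 0 +_) (sumBelow-suc m (f ∘ suc))) (sym (+-assoc (f 0) _ _))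

sumBelow-+ : ∀ m (f g : ℕ → ℕ) → sumBelow m (λ j → f j + g j) ≡ sumBelow m f + sumBelow m g
sumBelow-+ zero    f g = refl
sumBelow-+ (suc m) f g =
  trans (cong (f 0 + g 0 +_) (sumBelow-+ m (f ∘ suc) (g ∘ suc))) (interchange (f 0) (g 0) _ _)

sumBelow-cong : ∀ m {f g : ℕ → ℕ} → (∀ j → f j ≡ g j) → sumBelow m f ≡ sumBelow m g
sumBelow-cong zero    f≗g = refl
sumBelow-cong (suc m) f≗g = cong₂ _+_ (f≗g 0) (sumBelow-cong m (f≗g ∘ suc))

sumBelow-const : ∀ m {f : ℕ → ℕ} {c} → (∀ {j} → j < m → f j ≡ c) → sumBelow m f ≡ m * c
sumBelow-const zero    f≡c = refl
sumBelow-const (suc m) f≡c = cong₂ _+_ (f≡c (s≤s z≤n)) (sumBelow-const m (f≡c ∘ s≤s))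

restrict : (ℕ → Bool) → (ℕ → ℕ) → ℕ → ℕ
restrict X f j = if X j then f j else 0

size : ℕ → (ℕ → Bool) → ℕ
size m X = sumBelow m (restrict X (const 1))

restrict-∈ : ∀ {X : ℕ → Bool} {j} f → T (X j) → restrict X f j ≡ f j
restrict-∈ {X} {j} f Xj with X j
... | true = refl

restrict-∉ : ∀ {X : ℕ → Bool} {j} f → ¬ T (X j) → restrict X f j ≡ 0
restrict-∉ {X} {j} f ¬Xj with X j
... | true  = ⊥-elim (¬Xj _)
... | false = refl

_⊆_ : (ℕ → Bool) → (ℕ → Bool) → Set
X ⊆ Y = ∀ {j} → T (X j) → T (Y j)

_∖_ : (ℕ → Bool) → (ℕ → Bool) → ℕ → Bool
(Y ∖ X) j = if X j then false else Y j

sumBelow-⊆ : ∀ m {X Y : ℕ → Bool} f → X ⊆ Y →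
  sumBelow m (restrict Y f) ≡ sumBelow m (restrict X f) + sumBelow m (restrict (Y ∖ X) f)
sumBelow-⊆ m {X} {Y} f X⊆Y = trans (sumBelow-cong m split) (sumBelow-+ m _ _)
  where
  split : ∀ j → restrict Y f j ≡ restrict X f j + restrict (Y ∖ X) f j
  split j with X j | Y j | X⊆Y {j}
  ... | true  | true  | _    = sym (+-identityʳ (f j))
  ... | true  | false | X⇒Y = ⊥-elim (X⇒Y _)
  ... | false | _     | _    = refl

sumBelow-restrict-+ : ∀ m X u f →
  sumBelow m (restrict X (λ j → u + f j)) ≡ size m X * u + sumBelow m (restrict X f)
sumBelow-restrict-+ zero    X u f = refl
sumBelow-restrict-+ (suc m) X u f with X 0
... | true  = trans (cong (u + f 0 +_) (sumBelow-restrict-+ m (X ∘ suc) u (f ∘ suc)))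
                    (interchange u (f 0) _ _)
... | false = sumBelow-restrict-+ m (X ∘ suc) u (f ∘ suc)

member-of-nonempty : ∀ m X → 0 < size m X → ∃[ j ] j < m × T (X j)
member-of-nonempty (suc m) X 0<size with T? (X 0)
... | yes X0 = 0 , s≤s z≤n , X0
... | no ¬X0 with member-of-nonempty m (X ∘ suc)
                    (subst (0 <_) (cong (_+ size m (X ∘ suc)) (restrict-∉ {X} (const 1) ¬X0)) 0<size)
...   | j , j<m , Xj = suc j , s≤s j<m , Xj

prefix : ℕ → ℕ → Bool
prefix t j = j <ᵇ t

prefix-mono : ∀ {t t′} → t ≤ t′ → prefix t ⊆ prefix t′
prefix-mono {t} t≤t′ {j} j<t = <⇒<ᵇ (<-≤-trans (<ᵇ⇒< j t j<t) t≤t′)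

sumBelow-prefix : ∀ {t m} f → t ≤ m → sumBelow m (restrict (prefix t) f) ≡ sumBelow t f
sumBelow-prefix {zero}  {m} f _ = trans (sumBelow-const m (λ _ → refl)) (*-zeroʳ m)
sumBelow-prefix {suc t} f (s≤s t≤m) = cong (f 0 +_) (sumBelow-prefix (f ∘ suc) t≤m)

size-prefix : ∀ {t m} → t ≤ m → size m (prefix t) ≡ t
size-prefix {t} t≤m =
  trans (sumBelow-prefix (const 1) t≤m) (trans (sumBelow-const t (λ _ → refl)) (*-identityʳ t))

-- prefixSkipping r = {0, …, r − 1, r + 1}
prefixSkipping : ℕ → ℕ → Bool
prefixSkipping zero    zero          = false
prefixSkipping zero    (suc zero)    = true
prefixSkipping zero    (suc (suc _)) = false
prefixSkipping (suc r) zero          = true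
prefixSkipping (suc r) (suc j)       = prefixSkipping r j

prefixSkipping-< : ∀ {r j} → j < r → T (prefixSkipping r j)
prefixSkipping-< {suc r} {zero}  _         = _
prefixSkipping-< {suc r} {suc j} (s≤s j<r) = prefixSkipping-< j<r

prefixSkipping-≤ : ∀ {r j} → T (prefixSkipping r j) → j ≤ suc r
prefixSkipping-≤ {zero}  {suc zero} _   = s≤s z≤n
prefixSkipping-≤ {suc r} {zero}     _   = z≤n
prefixSkipping-≤ {suc r} {suc j}    rj  = s≤s (prefixSkipping-≤ {r} rj)

prefix⊆prefixSkipping : ∀ {t r} → t ≤ r → prefix t ⊆ prefixSkipping r
prefix⊆prefixSkipping {t} t≤r {j} j<t = prefixSkipping-< (<-≤-trans (<ᵇ⇒< j t j<t) t≤r)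

prefixSkipping⊆prefix : ∀ {r t} → suc r < t → prefixSkipping r ⊆ prefix t
prefixSkipping⊆prefix r+1<t rj = <⇒<ᵇ (≤-<-trans (prefixSkipping-≤ rj) r+1<t)

sumBelow-prefixSkipping : ∀ {r m} f → suc r < m →
  sumBelow m (restrict (prefixSkipping r) f) ≡ sumBelow r f + f (suc r)
sumBelow-prefixSkipping {zero} {suc (suc m)} f _ =
  trans (cong (f 1 +_) (sumBelow-prefix {0} {m} (λ j → f (2 + j)) z≤n)) (+-identityʳ (f 1))
sumBelow-prefixSkipping {zero} {suc zero} f (s≤s ())
sumBelow-prefixSkipping {suc r} {suc m} f (s≤s r+1<m) =
  trans (cong (f 0 +_) (sumBelow-prefixSkipping (f ∘ suc) r+1<m)) (sym (+-assoc (f 0) _ _))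

size-prefixSkipping : ∀ {r m} → suc r < m → size m (prefixSkipping r) ≡ suc r
size-prefixSkipping {r} r+1<m =
  trans (sumBelow-prefixSkipping (const 1) r+1<m)
        (trans (cong (_+ 1) (trans (sumBelow-const r (λ _ → refl)) (*-identityʳ r))) (+-comm r 1))

append : ℕ → (ℕ → Bool) → (ℕ → Bool) → ℕ → Bool
append zero    H X j       = X j
append (suc m) H X zero    = H zero
append (suc m) H X (suc j) = append m (H ∘ suc) X j

sumBelow-append : ∀ m l H X f →
  sumBelow (m + l) (restrict (append m H X) f)
    ≡ sumBelow m (restrict H f) + sumBelow l (restrict X (λ j → f (m + j)))
sumBelow-append zero    l H X f = refl
sumBelow-append (suc m) l H X f =
  trans (cong (restrict H f 0 +_) (sumBelow-append m l (H ∘ suc) X (f ∘ suc)))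
        (sym (+-assoc (restrict H f 0) _ _))

append-∈ : ∀ m H {X : ℕ → Bool} {j} → T (X j) → T (append m H X (m + j))
append-∈ zero    H Xj = Xj
append-∈ (suc m) H Xj = append-∈ m (H ∘ suc) Xj

%-cancelˡ-+ : ∀ n w {y z} → (w + y) % suc n ≡ (w + z) % suc n → y % suc n ≡ z % suc n
%-cancelˡ-+ n w {y} {z} w+y≡w+z = begin
  y % N                         ≡⟨ [m+kn]%n≡m%n y w N ⟨
  (y + w * N) % N               ≡⟨ cong (_% N) (shuffle y w n) ⟩
  (w + y + w * n) % N           ≡⟨ %-distribˡ-+ (w + y) (w * n) N ⟩
  ((w + y) % N + w * n % N) % N ≡⟨ cong (λ v → (v + w * n % N) % N) w+y≡w+z ⟩
  ((w + z) % N + w * n % N) % N ≡⟨ %-distribˡ-+ (w + z) (w * n) N ⟨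
  (w + z + w * n) % N           ≡⟨ cong (_% N) (shuffle z w n) ⟨
  (z + w * N) % N               ≡⟨ [m+kn]%n≡m%n z w N ⟩
  z % N                         ∎
  where
  open ≡-Reasoning
  N = suc n
  shuffle : ∀ x w n → x + w * suc n ≡ w + x + w * n
  shuffle = solve-∀

adjacent-≢-or-constant : ∀ (f : ℕ → ℕ) L →
  (∃[ r ] r < L × f r ≢ f (suc r)) ⊎ (∀ {j} → j ≤ L → f j ≡ f 0)
adjacent-≢-or-constant f zero = inj₂ λ { z≤n → refl }
adjacent-≢-or-constant f (suc L) with adjacent-≢-or-constant f L
... | inj₁ (r , r<L , fr≢) = inj₁ (r , m<n⇒m<1+n r<L , fr≢)
... | inj₂ constant with f L ≟ f (suc L)
...   | no fL≢ = inj₁ (L , ≤-refl , fL≢)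
...   | yes fL≡ = inj₂ constant′
  where
  constant′ : ∀ {j} → j ≤ suc L → f j ≡ f 0
  constant′ j≤L+1 with m≤n⇒m<n∨m≡n j≤L+1
  ... | inj₁ j<L+1 = constant (s≤s⁻¹ j<L+1)
  ... | inj₂ refl  = trans (sym fL≡) (constant ≤-refl)

∃-adjacent-≢ : ∀ (f : ℕ → ℕ) L {i j} → i ≤ L → j ≤ L → f i ≢ f j → ∃[ r ] r < L × f r ≢ f (suc r)
∃-adjacent-≢ f L i≤L j≤L fi≢fj with adjacent-≢-or-constant f L
... | inj₁ adjacent = adjacent
... | inj₂ constant = ⊥-elim (fi≢fj (trans (constant i≤L) (sym (constant j≤L))))

record ZeroSumSubset (n M : ℕ) (e : ℕ → ℕ) : Set where
  field
    members  : ℕ → Bool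
    nonempty : 0 < size M members
    proper   : size M members < suc n
    zero-sum : sumBelow M (restrict members e) % suc n ≡ 0

open ZeroSumSubset

zeroSumSubset-∖ : ∀ {n M e} {X Y : ℕ → Bool} → X ⊆ Y →
  sumBelow M (restrict X e) % suc n ≡ sumBelow M (restrict Y e) % suc n →
  size M X < size M Y → size M Y < suc n → ZeroSumSubset n M e
zeroSumSubset-∖ {n} {M} {e} {X} {Y} X⊆Y ΣX≡ΣY X<Y Y<N = record
  { members  = Y ∖ X
  ; nonempty = +-cancelˡ-< (size M X) 0 _
                 (subst₂ _<_ (sym (+-identityʳ _)) (sumBelow-⊆ M (const 1) X⊆Y) X<Y)
  ; proper   = ≤-<-trans (subst (size M (Y ∖ X) ≤_) (sym (sumBelow-⊆ M (const 1) X⊆Y))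
                                 (m≤n+m _ (size M X)))
                         Y<N
  ; zero-sum = %-cancelˡ-+ n (sumBelow M (restrict X e)) (begin
      (ΣX + sumBelow M (restrict (Y ∖ X) e)) % suc n ≡⟨ cong (_% suc n) (sumBelow-⊆ M e X⊆Y) ⟨
      sumBelow M (restrict Y e) % suc n              ≡⟨ ΣX≡ΣY ⟨
      ΣX % suc n                                     ≡⟨ cong (_% suc n) (+-identityʳ ΣX) ⟨
      (ΣX + 0) % suc n                               ∎)
  }
  where
  open ≡-Reasoning
  ΣX = sumBelow M (restrict X e)

-- The n + 2 candidates prefixSkipping r, prefix 0, …, prefix n have sizes at most n and are
-- pairwise nested except for prefix (r + 1) and prefixSkipping r, whose sums differ by
-- e (r + 1) − e r ≢ 0; so the two candidates given by the pigeonhole principle are nested.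
zeroSumSubset-window : ∀ n M e r → suc n ≤ M → suc r < suc n →
  e r % suc n ≢ e (suc r) % suc n → ZeroSumSubset n M e
zeroSumSubset-window n M e r N≤M r+1<N er≢er+1 = fromCollision (pigeonhole ≤-refl residue)
  where
  N = suc n

  candidate : Fin (suc N) → ℕ → Bool
  candidate = prefixSkipping r ∷ (prefix ∘ toℕ)

  σ : (ℕ → Bool) → ℕ
  σ X = sumBelow M (restrict X e) % N

  residue : Fin (suc N) → Fin N
  residue t = sumBelow M (restrict (candidate t) e) mod N

  size-prefix< : ∀ (b : Fin N) → size M (prefix (toℕ b)) ≡ toℕ b
  size-prefix< b = size-prefix (<⇒≤ (<-≤-trans (toℕ<n b) N≤M))

  size-skipping : size M (prefixSkipping r) ≡ suc r
  size-skipping = size-prefixSkipping (<-≤-trans r+1<N N≤M)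

  skipping≢prefix : ∀ (b : Fin N) → toℕ b ≡ suc r → σ (prefixSkipping r) ≢ σ (prefix (toℕ b))
  skipping≢prefix b b≡r+1 σ≡ = er≢er+1 (sym (%-cancelˡ-+ n (sumBelow r e) (begin
    (sumBelow r e + e (suc r)) % N ≡⟨ cong (_% N) (sumBelow-prefixSkipping e (<-≤-trans r+1<N N≤M)) ⟨
    σ (prefixSkipping r)           ≡⟨ σ≡ ⟩
    σ (prefix (toℕ b))             ≡⟨ cong (σ ∘ prefix) b≡r+1 ⟩
    σ (prefix (suc r))             ≡⟨ cong (_% N) (sumBelow-prefix e (<⇒≤ (<-≤-trans r+1<N N≤M))) ⟩
    sumBelow (suc r) e % N         ≡⟨ cong (_% N) (sumBelow-suc r e) ⟩
    (sumBelow r e + e r) % N       ∎)))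
    where open ≡-Reasoning

  collide : ∀ i j → i <ᶠ j → σ (candidate i) ≡ σ (candidate j) → ZeroSumSubset n M e
  collide zero (suc b) _ σ≡ with <-cmp (toℕ b) (suc r)
  ... | tri< b<r+1 _ _ = zeroSumSubset-∖ (prefix⊆prefixSkipping (s≤s⁻¹ b<r+1)) (sym σ≡)
                           (subst₂ _<_ (sym (size-prefix< b)) (sym size-skipping) b<r+1)
                           (subst (_< N) (sym size-skipping) r+1<N)
  ... | tri≈ _ b≡r+1 _ = ⊥-elim (skipping≢prefix b b≡r+1 σ≡)
  ... | tri> _ _ r+1<b = zeroSumSubset-∖ (prefixSkipping⊆prefix r+1<b) σ≡
                           (subst₂ _<_ (sym size-skipping) (sym (size-prefix< b)) r+1<b)
                           (subst (_< N) (sym (size-prefix< b)) (toℕ<n b))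
  collide (suc a) (suc b) (s≤s a<b) σ≡ =
    zeroSumSubset-∖ (prefix-mono (<⇒≤ a<b)) σ≡
      (subst₂ _<_ (sym (size-prefix< a)) (sym (size-prefix< b)) a<b)
      (subst (_< N) (sym (size-prefix< b)) (toℕ<n b))

  fromCollision : (∃[ i ] ∃[ j ] i <ᶠ j × residue i ≡ residue j) → ZeroSumSubset n M e
  fromCollision (i , j , i<j , residues≡) = collide i j i<j
    (trans (sym (toℕ-fromℕ< _)) (trans (cong toℕ residues≡) (toℕ-fromℕ< _)))

-- A differing pair at r = n does not fit into the window [0, n]; use [1, n + 1] instead.
zeroSumSubset-adjacent : ∀ n e r → r < suc n → e r % suc n ≢ e (suc r) % suc n →
  ZeroSumSubset n (suc (suc n)) e
zeroSumSubset-adjacent n e r r<N er≢er+1 with m≤n⇒m<n∨m≡n r<N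
... | inj₁ r+1<N = zeroSumSubset-window n (suc (suc n)) e r (n≤1+n _) r+1<N er≢er+1
zeroSumSubset-adjacent zero    e r _ er≢er+1 | inj₂ _ =
  ⊥-elim (er≢er+1 (trans (n%1≡0 (e r)) (sym (n%1≡0 (e (suc r))))))
zeroSumSubset-adjacent (suc n) e r _ er≢er+1 | inj₂ refl = record
  { members  = append 1 (const false) (members Z)
  ; nonempty = nonempty Z
  ; proper   = proper Z
  ; zero-sum = zero-sum Z
  }
  where Z = zeroSumSubset-window (suc n) (suc (suc n)) (e ∘ suc) n ≤-refl ≤-refl er≢er+1

zeroSumSubset : ∀ n e {i j} → i ≤ suc n → j ≤ suc n → e i % suc n ≢ e j % suc n →
  ZeroSumSubset n (suc (suc n)) e
zeroSumSubset n e i≤N j≤N ei≢ej with ∃-adjacent-≢ (λ j → e j % suc n) (suc n) i≤N j≤N ei≢ej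
... | r , r<N , er≢er+1 = zeroSumSubset-adjacent n e r r<N er≢er+1

-- Extension by the junk value 0 outside [0, m).
extend : ∀ {m} → (Fin m → ℕ) → ℕ → ℕ
extend {zero}  g _       = 0
extend {suc m} g zero    = g zero
extend {suc m} g (suc i) = extend (g ∘ suc) i

extend-toℕ : ∀ {m} (g : Fin m → ℕ) i → extend g (toℕ i) ≡ g i
extend-toℕ g zero    = refl
extend-toℕ g (suc i) = extend-toℕ (g ∘ suc) i

extend-const : ∀ {m t c} (g : Fin m → ℕ) → t ≤ m → (∀ i → toℕ i < t → g i ≡ c) →
  ∀ {j} → j < t → extend g j ≡ c
extend-const {suc m} g (s≤s t≤m) g≡c {zero}  _         = g≡c zero (s≤s z≤n)
extend-const {suc m} g (s≤s t≤m) g≡c {suc j} (s≤s j<t) =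
  extend-const (g ∘ suc) t≤m (λ i i<t → g≡c (suc i) (s≤s i<t)) j<t

sum-map-allFin-suc : ∀ K (h : Fin (suc K) → ℕ) →
  sum (map h (allFin (suc K))) ≡ h zero + sum (map (h ∘ suc) (allFin K))
sum-map-allFin-suc K h =
  cong (λ xs → h zero + sum xs) (trans (map-tabulate suc h) (sym (map-tabulate id (h ∘ suc))))

record Enumeration (m : ℕ) (X : ℕ → Bool) (K : ℕ) : Set where
  field
    index      : Fin K → Fin m
    increasing : StrictlyIncreasing index
    sum-index  : (g : Fin m → ℕ) →
                 sum (map (g ∘ index) (allFin K)) ≡ sumBelow m (restrict X (extend g))
    covers     : ∀ {i} → i < m → T (X i) → ∃[ k ] toℕ (index k) ≡ i

enumerate-keep : ∀ {m X K} → Enumeration m (X ∘ suc) K → T (X 0) → Enumeration (suc m) X (suc K)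
enumerate-keep {m} {X} {K} E X0 = record
  { index      = zero ∷ (suc ∘ index)
  ; increasing = increasing′
  ; sum-index  = λ g → begin
      sum (map (g ∘ (zero ∷ (suc ∘ index))) (allFin (suc K))) ≡⟨ sum-map-allFin-suc K _ ⟩
      g zero + sum (map (g ∘ suc ∘ index) (allFin K))         ≡⟨ cong (g zero +_) (sum-index (g ∘ suc)) ⟩
      g zero + rest g                                         ≡⟨ cong (_+ rest g) (restrict-∈ {X} (extend g) X0) ⟨
      sumBelow (suc m) (restrict X (extend g))                ∎
  ; covers     = covers′
  }
  where
  open Enumeration E
  open ≡-Reasoning
  rest : (Fin (suc m) → ℕ) → ℕ
  rest g = sumBelow m (restrict (X ∘ suc) (extend (g ∘ suc)))
  increasing′ : StrictlyIncreasing (zero ∷ (suc ∘ index))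
  increasing′ zero    zero    ()
  increasing′ zero    (suc j) _         = s≤s z≤n
  increasing′ (suc i) (suc j) (s≤s i<j) = s≤s (increasing i j i<j)
  covers′ : ∀ {i} → i < suc m → T (X i) → ∃[ k ] toℕ ((zero ∷ (suc ∘ index)) k) ≡ i
  covers′ {zero}  _         _  = zero , refl
  covers′ {suc i} (s≤s i<m) Xi with covers i<m Xi
  ... | k , k↦i = suc k , cong suc k↦i

enumerate-skip : ∀ {m X K} → Enumeration m (X ∘ suc) K → ¬ T (X 0) → Enumeration (suc m) X K
enumerate-skip {m} {X} {K} E ¬X0 = record
  { index      = suc ∘ index
  ; increasing = λ i j i<j → s≤s (increasing i j i<j)
  ; sum-index  = λ g → trans (sum-index (g ∘ suc)) (sym (cong (_+ rest g) (restrict-∉ {X} (extend g) ¬X0)))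
  ; covers     = covers′
  }
  where
  open Enumeration E
  rest : (Fin (suc m) → ℕ) → ℕ
  rest g = sumBelow m (restrict (X ∘ suc) (extend (g ∘ suc)))
  covers′ : ∀ {i} → i < suc m → T (X i) → ∃[ k ] toℕ (suc (index k)) ≡ i
  covers′ {zero}  _         X0 = ⊥-elim (¬X0 X0)
  covers′ {suc i} (s≤s i<m) Xi with covers i<m Xi
  ... | k , k↦i = k , cong suc k↦i

enumerate : ∀ m X → Enumeration m X (size m X)
enumerate zero    X = record { index = λ (); increasing = λ (); sum-index = λ _ → refl; covers = λ () }
enumerate (suc m) X with T? (X 0)
... | yes X0 = subst (Enumeration (suc m) X) (sym (cong (_+ size m (X ∘ suc)) (restrict-∈ {X} (const 1) X0)))
                 (enumerate-keep (enumerate m (X ∘ suc)) X0)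
... | no ¬X0 = subst (Enumeration (suc m) X) (sym (cong (_+ size m (X ∘ suc)) (restrict-∉ {X} (const 1) ¬X0)))
                 (enumerate-skip (enumerate m (X ∘ suc)) ¬X0)

toℕ-+-%-injective : ∀ {n} u {x y : Fin (suc n)} → (u + toℕ x) % suc n ≡ (u + toℕ y) % suc n → x ≡ y
toℕ-+-%-injective {n} u {x} {y} u+x≡u+y = toℕ-injective (begin
  toℕ x          ≡⟨ m<n⇒m%n≡m (toℕ<n x) ⟨
  toℕ x % suc n  ≡⟨ %-cancelˡ-+ n u u+x≡u+y ⟩
  toℕ y % suc n  ≡⟨ m<n⇒m%n≡m (toℕ<n y) ⟩
  toℕ y          ∎)
  where open ≡-Reasoning

-- h ≡ −k and c ≡ −u modulo h + k = u + c, hence h c ≡ k u.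
complements-*-% : ∀ n {h k u c} S → h + k ≡ suc n → u + c ≡ suc n →
  (h * c + S) % suc n ≡ (k * u + S) % suc n
complements-*-% n {h} {k} {u} {c} S h+k≡N u+c≡N = begin
  (h * c + S) % N                ≡⟨ [m+kn]%n≡m%n (h * c + S) k N ⟨
  (h * c + S + k * N) % N        ≡⟨ cong (λ v → (h * c + S + k * v) % N) u+c≡N ⟨
  (h * c + S + k * (u + c)) % N  ≡⟨ cong (_% N) (regroup h c S k u) ⟩
  (k * u + S + c * (h + k)) % N  ≡⟨ cong (λ v → (k * u + S + c * v) % N) h+k≡N ⟩
  (k * u + S + c * N) % N        ≡⟨ [m+kn]%n≡m%n (k * u + S) c N ⟩
  (k * u + S) % N                ∎
  where
  open ≡-Reasoning
  N = suc n
  regroup : ∀ h c S k u → h * c + S + k * (u + c) ≡ k * u + S + c * (h + k)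
  regroup = solve-∀

padWithHead : ∀ {n M e} → ZeroSumSubset n M e → ℕ → Bool
padWithHead {n} {M} Z = append (suc n) (prefix (suc n ∸ size M (members Z))) (members Z)

enumerate-padWithHead : ∀ {n M e L} (Z : ZeroSumSubset n M e) → suc n + M ≡ L →
  Enumeration L (padWithHead Z) (suc n)
enumerate-padWithHead {n} {M} Z refl =
  subst (Enumeration (suc n + M) (padWithHead Z)) size≡N (enumerate _ _)
  where
  open ≡-Reasoning
  N = suc n
  k = size M (members Z)
  size≡N : size (N + M) (padWithHead Z) ≡ N
  size≡N = begin
    size (N + M) (padWithHead Z)          ≡⟨ sumBelow-append N M (prefix (N ∸ k)) (members Z) (const 1) ⟩
    size N (prefix (N ∸ k)) + k           ≡⟨ cong (_+ k) (size-prefix (m∸n≤m N k)) ⟩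
    N ∸ k + k                             ≡⟨ m∸n+n≡m (<⇒≤ (proper Z)) ⟩
    N                                     ∎

sum-padWithHead : ∀ {n M L} (A : ℕ → ℕ) → (∀ {i} → i < suc n → A i ≡ A 0) → A 0 ≤ suc n →
  (Z : ZeroSumSubset n M (λ j → (suc n ∸ A 0) + A (suc n + j))) → suc n + M ≡ L →
  sumBelow L (restrict (padWithHead Z) A) % suc n ≡ 0
sum-padWithHead {n} {M} A head≡ c≤N Z refl = begin
  sumBelow (N + M) (restrict (padWithHead Z) A) % N  ≡⟨ cong (_% N) (sumBelow-append N M (prefix h) X A) ⟩
  (sumBelow N (restrict (prefix h) A) + S) % N       ≡⟨ cong (λ v → (v + S) % N) head-sum ⟩
  (h * c + S) % N                                    ≡⟨ complements-*-% n {h} {k} {u} {c} S h+k≡N u+c≡N ⟩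
  (k * u + S) % N                                    ≡⟨ cong (_% N) (sumBelow-restrict-+ M X u (λ j → A (N + j))) ⟨
  sumBelow M (restrict X (λ j → u + A (N + j))) % N  ≡⟨ zero-sum Z ⟩
  0                                                  ∎
  where
  open ≡-Reasoning
  N = suc n
  X = members Z
  k = size M X
  h = N ∸ k
  c = A 0
  u = N ∸ c
  S = sumBelow M (restrict X (λ j → A (N + j)))
  h+k≡N : h + k ≡ N
  h+k≡N = m∸n+n≡m (<⇒≤ (proper Z))
  u+c≡N : u + c ≡ N
  u+c≡N = m∸n+n≡m c≤N
  head-sum : sumBelow N (restrict (prefix h) A) ≡ h * c
  head-sum = trans (sumBelow-prefix A (m∸n≤m N k))
                   (sumBelow-const h (λ i<h → head≡ (<-≤-trans i<h (m∸n≤m N k))))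

hits-head : ∀ {n M e L K} (Z : ZeroSumSubset n M e) (E : Enumeration L (padWithHead Z) K) →
  suc n + M ≡ L → ∃[ k ] toℕ (Enumeration.index E k) < suc n
hits-head {n} {M} Z E refl with Enumeration.covers E (s≤s z≤n) (<⇒<ᵇ (m<n⇒0<n∸m (proper Z)))
... | k , k↦0 = k , subst (_< suc n) (sym k↦0) (s≤s z≤n)

hits-tail : ∀ {n M e L K} (Z : ZeroSumSubset n M e) (E : Enumeration L (padWithHead Z) K) →
  suc n + M ≡ L → ∃[ k ] suc n ≤ toℕ (Enumeration.index E k)
hits-tail {n} {M} Z E refl with member-of-nonempty M (members Z) (nonempty Z)
... | j , j<M , Xj
  with Enumeration.covers E (+-monoʳ-< (suc n) j<M)
                            (append-∈ (suc n) (prefix (suc n ∸ size M (members Z))) Xj)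
...   | k , k↦N+j = k , subst (suc n ≤_) (sym k↦N+j) (m≤m+n (suc n) j)

lemma3p1 : (n : ℕ) → let N = suc n in
    (a : Fin (suc (2 * N)) → Fin N) →
    (∀ (i : Fin (suc (2 * N))) → toℕ i < N → a i ≡ a zero) →
    (∀ (i : Fin (suc (2 * N))) → N ≤ toℕ i → a i ≢ a zero) →
    (∃ λ (i : Fin (suc (2 * N))) → ∃ λ (j : Fin (suc (2 * N))) →
       N ≤ toℕ i × N ≤ toℕ j × a i ≢ a j) →
    ∃ λ (s : Fin N → Fin (suc (2 * N))) →
      StrictlyIncreasing s ×
      sumZN (λ k → a (s k)) ≡ 0 ×
      (∃ λ (k : Fin N) → a (s k) ≡ a zero) ×
      (∃ λ (k : Fin N) → a (s k) ≢ a zero)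
lemma3p1 n a onHead offHead (i₀ , j₀ , N≤i₀ , N≤j₀ , ai₀≢aj₀) =
  index , increasing , sum≡0 ,
  map₂ (onHead _) (hits-head Z E N+[1+N]≡L) , map₂ (offHead _) (hits-tail Z E N+[1+N]≡L)
  where
  N = suc n
  L = suc (2 * N)
  A : ℕ → ℕ
  A = extend (toℕ ∘ a)
  u : ℕ
  u = N ∸ A 0

  N+[1+N]≡L : N + suc N ≡ L
  N+[1+N]≡L = trans (+-suc N N) (cong (λ v → suc (N + v)) (sym (+-identityʳ N)))

  offset≤N : ∀ (i : Fin L) → toℕ i ∸ N ≤ N
  offset≤N i = ≤-trans (m≤n+o⇒m∸n≤o (toℕ i) N (s≤s⁻¹ (toℕ<n i))) (≤-reflexive (+-identityʳ N))

  tail-value : ∀ {i} → N ≤ toℕ i → A (N + (toℕ i ∸ N)) ≡ toℕ (a i)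
  tail-value {i} N≤i = trans (cong A (m+[n∸m]≡n N≤i)) (extend-toℕ (toℕ ∘ a) i)

  Z : ZeroSumSubset n (suc N) (λ j → u + A (N + j))
  Z = zeroSumSubset n _ (offset≤N i₀) (offset≤N j₀) (ai₀≢aj₀ ∘ toℕ-+-%-injective u ∘
        subst₂ (λ x y → (u + x) % N ≡ (u + y) % N) (tail-value N≤i₀) (tail-value N≤j₀))

  E : Enumeration L (padWithHead Z) N
  E = enumerate-padWithHead Z N+[1+N]≡L
  open Enumeration E

  sum≡0 : sumZN (λ k → a (index k)) ≡ 0
  sum≡0 = trans (cong (_% N) (sum-index (toℕ ∘ a)))
    (sum-padWithHead A (extend-const (toℕ ∘ a) (m≤n⇒m≤1+n (m≤m+n N _)) (λ i → cong toℕ ∘ onHead i))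
                     (<⇒≤ (toℕ<n (a zero))) Z N+[1+N]≡L)
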